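{- Let $Q$ be an IPSTN problem given by a phylogeny $\langle V,E,I,S,f\rangle$ with root $R$ and interval function $v\mapsto(\tau_{\min}(v),\tau_{\max}(v))$. Let $X$ be a set of 2-element subsets of $V\!\uparrow=\{v\!\uparrow : v\in V\setminus\{R\}\}$, and let $V_X$ be the union of all elements of $X$. Then $X$ is a solution to $Q$ if and only if (i) $X$ is admissible, and (ii) there exists a real-valued function $\tau$ on $V\cup V_X$ such that (a) for every $v\in V$, $\tau_{\min}(v)<\tau(v)<\tau_{\max}(v)$; (b) for every $v\in V\setminus\{R\}$, $\tau(\mathit{par}(v))<\tau(v)$; (c) for every element $v\!\uparrow$ of $V_X$, $\tau(\mathit{par}(v))<\tau(v\!\uparrow)<\tau(v)$; (d) for every element $\{u\!\uparrow,v\!\uparrow\}$ of $X$, $\tau(u\!\uparrow)=\tau(v\!\uparrow)$.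
   Context: A rooted tree is a digraph with a vertex of in-degree 0 (the root) such that every other vertex has in-degree 1 and is reachable from the root; a leaf is a vertex of out-degree 0. A phylogeny is a finite rooted tree $\langle V,E\rangle$ with finite sets $I$ (characters) and $S$ (states) and a function $f:L\times I\to S$, where $L$ is the set of leaves. For $v\ne R$, $\mathit{par}(v)$ denotes the parent of $v$. A temporal phylogeny is a phylogeny with a function $\tau:V\to\mathbb{R}$ with $\tau(u)<\tau(v)$ for every edge $\langle u,v\rangle$. Events and contacts: for a temporal phylogeny, an event is a pair $v\!\uparrow\! t$ with $v\in V\setminus\{R\}$ and $t\in\mathbb{R}$ with $\tau(\mathit{par}(v))<t\le\tau(v)$. Events $v\!\uparrow\! t$, $v'\!\uparrow\! t'$ are concurrent if $t=t'$; a contact is a set of two different concurrent events. A finite set $C$ of contacts is simple if every event $v\!\uparrow\! t$ belonging to a contact in $C$ has $t<\tau(v)$, and for every vertex $v$ there is at most one $t$ with $v\!\uparrow\! t$ belonging to some contact in $C$. For simple $C$, let $V_C$ be the union of the contacts in $C$; the network $\langle V\cup V_C,E_C\rangle$ has edge set obtained from $E$ by replacing, for each event $v\!\uparrow\! t\in V_C$, the edge $\langle \mathit{par}(v),v\rangle$ with $\langle \mathit{par}(v),v\!\uparrow\! t\rangle$ and $\langle v\!\uparrow\! t,v\rangle$, and then adding for each contact $\{u\!\uparrow\! t,v\!\uparrow\! t\}\in C$ both edges $\langle u\!\uparrow\! t,v\!\uparrow\! t\rangle$ and $\langle v\!\uparrow\! t,u\!\uparrow\! t\rangle$. $C$ is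 perfect if there is $g:(V\cup V_C)\times I\to S$ with $g(v,i)=f(v,i)$ for every leaf $v$ and $i\in I$, and such that for every $i\in I$, $s\in S$, if $V_{is}=\{x\in V\cup V_C : g(x,i)=s\}$ is nonempty then the digraph $\langle V\cup V_C,E_C\rangle$ has a subgraph with vertex set $V_{is}$ that is a rooted tree. For each $v\in V\setminus\{R\}$, $v\!\uparrow$ is a new symbol. The summary of a simple set $C$ of contacts is obtained by replacing each element $v\!\uparrow\! t$ of every contact in $C$ by $v\!\uparrow$. An IPSTN problem is given by a phylogeny $\langle V,E,I,S,f\rangle$ and a function assigning to each $v\in V$ an open interval $(\tau_{\min}(v),\tau_{\max}(v))$ with $\tau_{\min}(v)\in\mathbb{R}\cup\{ -\infty\}$, $\tau_{\max}(v)\in\mathbb{R}\cup\{+\infty\}$, $\tau_{\min}(v)<\tau_{\max}(v)$. A solution is a set of 2-element subsets of $V\!\uparrow$ that is the summary of a perfect simple set of contacts for some temporal phylogeny $\langle V,E,I,S,f,\tau\rangle$ with $\tau_{\min}(v)<\tau(v)<\tau_{\max}(v)$ for all $v\in V$. Admissibility: for a set $X$ of 2-element subsets of $V\!\uparrow$, let $V_X$ be the union of the elements of $X$, and let $E_X$ be obtained from $E$ by replacing, for every $v\!\uparrow\in V_X$, the edge $\langle\mathit{par}(v),v\rangle$ with $\langle\mathit{par}(v),v\!\uparrow\rangle$ and $\langle v\!\uparrow,v\rangle$, and adding for each $\{u\!\uparrow,v\!\uparrow\}\in X$ the edges $\langle u\!\uparrow,v\!\uparrow\rangle$ and $\langle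 v\!\uparrow,u\!\uparrow\rangle$. $X$ is admissible if there exists $g:(V\cup V_X)\times I\to S$ with $g(v,i)=f(v,i)$ for every leaf $v$ and $i\in I$, and such that for every $i\in I$, $s\in S$, if $V_{is}=\{x\in V\cup V_X : g(x,i)=s\}$ is nonempty then the digraph $\langle V\cup V_X,E_X\rangle$ has a subgraph with vertex set $V_{is}$ that is a rooted tree. -}

module Defs where

open import Level using (0ℓ)
open import Data.Nat using (ℕ)
open import Data.Fin using (Fin)
open import Data.Bool using (Bool; true; false)
open import Data.Unit using (⊤)
open import Data.Empty using (⊥)
open import Data.Product using (Σ; Σ-syntax; _×_; _,_; proj₁)
open import Data.Sum using (_⊎_; inj₁; inj₂)
open import Data.List using (List)
open import Data.List.Relation.Unary.Any using (Any)
open import Data.List.Relation.Unary.All using (All)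
open import Relation.Nullary using (¬_)
open import Relation.Binary.PropositionalEquality using (_≡_; _≢_)
open import Relation.Binary.Construct.Closure.ReflexiveTransitive using (Star)
open import Relation.Binary.Structures using (IsStrictTotalOrder)
open import Algebra.Structures using (IsCommutativeRing)
open import Function.Bundles using (_⇔_)

record RealNumbers : Set₁ where
  infixl 6 _+_
  infixl 7 _*_
  infix 4 _<_
  field
    ℝ     : Set
    0r 1r : ℝ
    _+_ _*_ : ℝ → ℝ → ℝ
    -_    : ℝ → ℝ
    _<_   : ℝ → ℝ → Set
    isCommutativeRing : IsCommutativeRing _≡_ _+_ _*_ -_ 0r 1r
    0≢1   : 0r ≢ 1r
    inverse : ∀ x → x ≢ 0r → Σ ℝ λ y → x * y ≡ 1r
    isStrictTotalOrder : IsStrictTotalOrder _≡_ _<_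
    +-mono-< : ∀ {x y} z → x < y → x + z < y + z
    *-pos    : ∀ {x y} → 0r < x → 0r < y → 0r < x * y
    complete : (P : ℝ → Set) → Σ ℝ P → Σ ℝ (λ b → ∀ x → P x → (x < b ⊎ x ≡ b)) →
               Σ ℝ λ s → (∀ x → P x → (x < s ⊎ x ≡ s)) ×
                         (∀ b → (∀ x → P x → (x < b ⊎ x ≡ b)) → (s < b ⊎ s ≡ b))

IsRootedTreeAt : {A : Set} → A → (A → Set) → (A → A → Set) → Set
IsRootedTreeAt {A} r W D =
  W r ×
  (∀ x → ¬ D x r) ×
  (∀ v → W v → v ≢ r → Σ A λ u → D u v × (∀ u' → D u' v → u' ≡ u)) ×
  (∀ v → W v → Star D r v)

IsRootedTree : {A : Set} → (A → Set) → (A → A → Set) → Set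
IsRootedTree {A} W D = Σ A λ r → IsRootedTreeAt r W D

HasRootedSubtreeOn : {A : Set} → (A → A → Set) → (A → Set) → Set₁
HasRootedSubtreeOn {A} D W =
  Σ (A → A → Set) λ D' →
    (∀ x y → D' x y → D x y) ×
    (∀ x y → D' x y → W x × W y) ×
    IsRootedTree W D'

-- Phylogenies.  V = Fin n, I = Fin nI, S = Fin nS.
-- par is the parent function (its value at the root is irrelevant).
-- f is given on all of V × I but only its values on leaves are used.

record Phylogeny : Set₁ where
  field
    n    : ℕ
    E    : Fin n → Fin n → Set
    R    : Fin n
    tree : IsRootedTreeAt R (λ _ → ⊤) E
    par  : Fin n → Fin n
    par-edge : ∀ v → v ≢ R → E (par v) v
    nI nS : ℕ
    f    : Fin n → Fin nI → Fin nS

  IsLeaf : Fin n → Set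
  IsLeaf v = ∀ w → ¬ E v w

-- Generic network: base vertices Fin n plus "up" vertices U (inj₂),
-- an up vertex w subdividing the edge ⟨par (base w), base w⟩, and
-- symmetric links between up vertices.

module Network (P : Phylogeny) {U : Set}
               (inUp : U → Set) (base : U → Fin (Phylogeny.n P))
               (link : U → U → Set) where
  open Phylogeny P

  Vtx : Set
  Vtx = Fin n ⊎ U

  Member : Vtx → Set
  Member (inj₁ _) = ⊤
  Member (inj₂ w) = inUp w

  data Edge : Vtx → Vtx → Set where
    tree-edge : ∀ {u v} → E u v → (∀ w → inUp w → base w ≢ v) → Edge (inj₁ u) (inj₁ v)
    to-up     : ∀ {w} → inUp w → Edge (inj₁ (par (base w))) (inj₂ w)
    from-up   : ∀ {w} → inUp w → Edge (inj₂ w) (inj₁ (base w))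
    linked    : ∀ {w w'} → link w w' → Edge (inj₂ w) (inj₂ w')

  -- existence of g as in the definitions of "perfect" / "admissible"
  Compatible : Set₁
  Compatible =
    Σ (Vtx → Fin nI → Fin nS) λ g →
      (∀ v → IsLeaf v → ∀ i → g (inj₁ v) i ≡ f v i) ×
      (∀ i s → Σ Vtx (λ x → Member x × g x i ≡ s) →
         HasRootedSubtreeOn Edge (λ x → Member x × g x i ≡ s))

-- Sets of 2-element subsets of V↑ (v↑ is represented by v, v ≢ R):
-- a decidable symmetric irreflexive relation on non-root vertices.

record PairSet (P : Phylogeny) : Set where
  open Phylogeny P
  field
    rel    : Fin n → Fin n → Bool
    sym    : ∀ u v → rel u v ≡ rel v u
    irrefl : ∀ v → rel v v ≡ false
    nonroot : ∀ u v → rel u v ≡ true → u ≢ R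

module _ {P : Phylogeny} (X : PairSet P) where
  open Phylogeny P
  open PairSet X

  InVX : Fin n → Set
  InVX v = Σ (Fin n) λ u → rel u v ≡ true

  Admissible : Set₁
  Admissible = Network.Compatible P InVX (λ v → v) (λ u v → rel u v ≡ true)

module WithReals (ℝs : RealNumbers) where
  open RealNumbers ℝs

  _≤_ : ℝ → ℝ → Set
  x ≤ y = x < y ⊎ x ≡ y

  data ℝ̄ : Set where
    -∞  : ℝ̄
    ⟨_⟩ : ℝ → ℝ̄
    +∞  : ℝ̄

  data _<̄_ : ℝ̄ → ℝ̄ → Set where
    -∞<⟨⟩ : ∀ {x} → -∞ <̄ ⟨ x ⟩
    -∞<+∞ : -∞ <̄ +∞
    ⟨⟩<⟨⟩ : ∀ {x y} → x < y → ⟨ x ⟩ <̄ ⟨ y ⟩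
    ⟨⟩<+∞ : ∀ {x} → ⟨ x ⟩ <̄ +∞

  module _ (P : Phylogeny) where
    open Phylogeny P

    IsTemporal : (Fin n → ℝ) → Set
    IsTemporal τ = ∀ u v → E u v → τ u < τ v

    record Contact (τ : Fin n → ℝ) : Set where
      field
        u v  : Fin n
        t    : ℝ
        u≢v  : u ≢ v
        u≢R  : u ≢ R
        v≢R  : v ≢ R
        u-lo : τ (par u) < t
        u-hi : t ≤ τ u
        v-lo : τ (par v) < t
        v-hi : t ≤ τ v

    module _ {τ : Fin n → ℝ} (C : List (Contact τ)) where
      open Contact

      Event : Set
      Event = Fin n × ℝ

      InVC : Event → Set
      InVC e = Any (λ c → e ≡ (u c , t c) ⊎ e ≡ (v c , t c)) C

      LinkC : Event → Event → Set
      LinkC e e' = Any (λ c → (e ≡ (u c , t c) × e' ≡ (v c , t c))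
                             ⊎ (e ≡ (v c , t c) × e' ≡ (u c , t c))) C

      Simple : Set
      Simple = All (λ c → t c < τ (u c) × t c < τ (v c)) C ×
               (∀ w t₁ t₂ → InVC (w , t₁) → InVC (w , t₂) → t₁ ≡ t₂)

      Perfect : Set₁
      Perfect = Network.Compatible P InVC proj₁ LinkC

      SummaryIs : PairSet P → Set
      SummaryIs X = ∀ a b → (PairSet.rel X a b ≡ true ⇔
        Any (λ c → (u c ≡ a × v c ≡ b) ⊎ (u c ≡ b × v c ≡ a)) C)

    IsSolution : (τmin τmax : Fin n → ℝ̄) → PairSet P → Set₁
    IsSolution τmin τmax X =
      Σ (Fin n → ℝ) λ τ →
        (∀ v → τmin v <̄ ⟨ τ v ⟩ × ⟨ τ v ⟩ <̄ τmax v) ×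
        IsTemporal τ ×
        Σ (List (Contact τ)) λ C → Simple C × Perfect C × SummaryIs C X

    -- condition (ii); τ on V ∪ V_X with inj₁ v = v and inj₂ v = v↑
    TimingCondition : (τmin τmax : Fin n → ℝ̄) → PairSet P → Set
    TimingCondition τmin τmax X =
      Σ (Fin n ⊎ Fin n → ℝ) λ τ →
        (∀ v → τmin v <̄ ⟨ τ (inj₁ v) ⟩ × ⟨ τ (inj₁ v) ⟩ <̄ τmax v) ×
        (∀ v → v ≢ R → τ (inj₁ (par v)) < τ (inj₁ v)) ×
        (∀ v → InVX X v → τ (inj₁ (par v)) < τ (inj₂ v) × τ (inj₂ v) < τ (inj₁ v)) ×
        (∀ u v → PairSet.rel X u v ≡ true → τ (inj₂ u) ≡ τ (inj₂ v))

{-# OPTIONS --safe #-}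
-- A simple set C of contacts has at most one event on each edge, so
-- v↑t ↦ v↑ is a bijection from the events of C onto V_X, X the summary
-- of C, matching the edges of the two networks; hence the same labelling
-- g shows C perfect exactly when it shows X admissible.  The times of
-- these events extend τ to V ∪ V_X satisfying (a)-(d); conversely such an
-- extension turns every {u↑, v↑} ∈ X into the contact {u↑t, v↑t} with
-- t = τ(u↑) = τ(v↑), the two times being equal by (d).
module Submission where

open import Defs
open import Data.Bool using (true)
import Data.Bool as Bool
open import Data.Fin using (Fin; _≟_)
open import Data.List using (List; []; _∷_; map; cartesianProduct; allFin)
open import Data.List.Membership.Propositional using (_∈_; find; lose)
open import Data.List.Membership.Propositional.Properties
  using (∈-lookup; ∈-map⁺; ∈-allFin; ∈-cartesianProduct⁺)
import Data.List.Relation.Unary.All as All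
import Data.List.Relation.Unary.All.Properties as All
open import Data.List.Relation.Unary.Any as Any using (Any; here; there; any?)
import Data.List.Relation.Unary.Any.Properties as Any
open import Data.Product using (Σ; _×_; _,_; proj₁; proj₂)
open import Data.Sum as Sum using (_⊎_; inj₁; inj₂; [_,_])
open import Data.Unit using (tt)
open import Function using (_∘_)
open import Function.Bundles using (_⇔_; mk⇔; Equivalence)
open import Relation.Binary.Construct.Closure.ReflexiveTransitive using (Star; gmap)
open import Relation.Binary.PropositionalEquality using (_≡_; _≢_; refl; sym; trans; cong; subst; subst₂)
open import Relation.Nullary using (¬_; yes; no; contradiction; _⊎-dec_)
open import Relation.Unary using (Decidable; Irrelevant)
open import Axiom.UniquenessOfIdentityProofs using (module Decidable⇒UIP)

module _ {A B : Set} {D₁ : A → A → Set} {D₂ : B → B → Set} {W₁ : A → Set} {W₂ : B → Set}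
         (to : A → B) (from : B → A)
         (to-W : ∀ {x} → W₁ x → W₂ (to x)) (from-W : ∀ {y} → W₂ y → W₁ (from y))
         (from∘to : ∀ {x} → W₁ x → from (to x) ≡ x) (to∘from : ∀ {y} → W₂ y → to (from y) ≡ y)
         (from-edge : ∀ {y y′} → D₂ y y′ → D₁ (from y) (from y′)) where

  hasRootedSubtreeOn-transport : HasRootedSubtreeOn D₂ W₂ → HasRootedSubtreeOn D₁ W₁
  hasRootedSubtreeOn-transport (T , T⊆D₂ , T⊆W₂ , r , W₂r , no-in , parent , reach) =
    T₁ , T₁⊆D₁ , (λ _ _ (_ , wx , wx′) → wx , wx′) , from r , from-W W₂r , no-in₁ , parent₁ , reach₁
    where
    T₁ : A → A → Set
    T₁ x x′ = T (to x) (to x′) × W₁ x × W₁ x′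

    T₁⊆D₁ : ∀ x x′ → T₁ x x′ → D₁ x x′
    T₁⊆D₁ x x′ (e , wx , wx′) = subst₂ D₁ (from∘to wx) (from∘to wx′) (from-edge (T⊆D₂ _ _ e))

    from-T : ∀ {y y′} → T y y′ → T₁ (from y) (from y′)
    from-T {y} {y′} e with T⊆W₂ y y′ e
    ... | wy , wy′ = subst₂ T (sym (to∘from wy)) (sym (to∘from wy′)) e , from-W wy , from-W wy′

    no-in₁ : ∀ x → ¬ T₁ x (from r)
    no-in₁ x (e , _) = no-in (to x) (subst (T (to x)) (to∘from W₂r) e)

    parent₁ : ∀ x → W₁ x → x ≢ from r → Σ A λ p → T₁ p x × (∀ p′ → T₁ p′ x → p′ ≡ p)
    parent₁ x wx x≢r with parent (to x) (to-W wx) (λ eq → x≢r (trans (sym (from∘to wx)) (cong from eq)))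
    ... | p , e , unique =
      from p , subst (T₁ (from p)) (from∘to wx) (from-T e) ,
      λ p′ (e′ , wp′ , _) → trans (sym (from∘to wp′)) (cong from (unique (to p′) e′))

    reach₁ : ∀ x → W₁ x → Star T₁ (from r) x
    reach₁ x wx = subst (Star T₁ (from r)) (from∘to wx) (gmap from from-T (reach (to x) (to-W wx)))

module _ (P : Phylogeny) {U₁ U₂ : Set}
         (in₁ : U₁ → Set) (base₁ : U₁ → Fin (Phylogeny.n P)) (link₁ : U₁ → U₁ → Set)
         (in₂ : U₂ → Set) (base₂ : U₂ → Fin (Phylogeny.n P)) (link₂ : U₂ → U₂ → Set)
         (to : U₁ → U₂) (from : U₂ → U₁)
         (to-in : ∀ {w} → in₁ w → in₂ (to w)) (from-in : ∀ {w} → in₂ w → in₁ (from w))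
         (base-to : ∀ {w} → in₁ w → base₂ (to w) ≡ base₁ w)
         (base-from : ∀ {w} → in₂ w → base₁ (from w) ≡ base₂ w)
         (from-link : ∀ {w w′} → link₂ w w′ → link₁ (from w) (from w′))
         (from∘to : ∀ {w} → in₁ w → from (to w) ≡ w) (to∘from : ∀ {w} → in₂ w → to (from w) ≡ w)
         where
  open Phylogeny P
  private
    module N₁ = Network P in₁ base₁ link₁
    module N₂ = Network P in₂ base₂ link₂

  toVtx : N₁.Vtx → N₂.Vtx
  toVtx = Sum.map₂ to

  fromVtx : N₂.Vtx → N₁.Vtx
  fromVtx = Sum.map₂ from

  toVtx-Member : ∀ {x} → N₁.Member x → N₂.Member (toVtx x)
  toVtx-Member {inj₁ _} _ = tt
  toVtx-Member {inj₂ _} m = to-in m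

  fromVtx-Member : ∀ {y} → N₂.Member y → N₁.Member (fromVtx y)
  fromVtx-Member {inj₁ _} _ = tt
  fromVtx-Member {inj₂ _} m = from-in m

  fromVtx∘toVtx : ∀ {x} → N₁.Member x → fromVtx (toVtx x) ≡ x
  fromVtx∘toVtx {inj₁ _} _ = refl
  fromVtx∘toVtx {inj₂ _} m = cong inj₂ (from∘to m)

  toVtx∘fromVtx : ∀ {y} → N₂.Member y → toVtx (fromVtx y) ≡ y
  toVtx∘fromVtx {inj₁ _} _ = refl
  toVtx∘fromVtx {inj₂ _} m = cong inj₂ (to∘from m)

  fromVtx-Edge : ∀ {y y′} → N₂.Edge y y′ → N₁.Edge (fromVtx y) (fromVtx y′)
  fromVtx-Edge (N₂.tree-edge e unsubdivided) =
    N₁.tree-edge e (λ w m → unsubdivided (to w) (to-in m) ∘ trans (base-to m))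
  fromVtx-Edge (N₂.to-up {w} m) =
    subst (λ z → N₁.Edge (inj₁ (par z)) (inj₂ (from w))) (base-from m) (N₁.to-up (from-in m))
  fromVtx-Edge (N₂.from-up {w} m) =
    subst (λ z → N₁.Edge (inj₂ (from w)) (inj₁ z)) (base-from m) (N₁.from-up (from-in m))
  fromVtx-Edge (N₂.linked l) = N₁.linked (from-link l)

  compatible-transport : N₂.Compatible → N₁.Compatible
  compatible-transport (g , g-leaf , g-trees) = g ∘ toVtx , g-leaf , trees
    where
    trees : ∀ i s → Σ N₁.Vtx (λ x → N₁.Member x × g (toVtx x) i ≡ s) →
            HasRootedSubtreeOn N₁.Edge (λ x → N₁.Member x × g (toVtx x) i ≡ s)
    trees i s (x , mx , gx) =
      hasRootedSubtreeOn-transport toVtx fromVtx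
        (λ {x} (m , e) → toVtx-Member {x} m , e)
        (λ {y} (m , e) → fromVtx-Member {y} m , trans (cong (λ z → g z i) (toVtx∘fromVtx {y} m)) e)
        (λ {x} → fromVtx∘toVtx {x} ∘ proj₁) (λ {y} → toVtx∘fromVtx {y} ∘ proj₁) fromVtx-Edge
        (g-trees i s (toVtx x , toVtx-Member {x} mx , gx))

module _ {A : Set} {P : A → Set} (P? : Decidable P) where

  witnesses : List A → List (Σ A P)
  witnesses [] = []
  witnesses (x ∷ xs) with P? x
  ... | yes px = (x , px) ∷ witnesses xs
  ... | no  _  = witnesses xs

  ∈-witnesses : Irrelevant P → ∀ {x xs} → x ∈ xs → (px : P x) → (x , px) ∈ witnesses xs
  ∈-witnesses P-irr {x} (here refl) px with P? x
  ... | yes px′ = here (cong (x ,_) (P-irr px px′))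
  ... | no ¬px  = contradiction px ¬px
  ∈-witnesses P-irr {xs = y ∷ _} (there x∈xs) px with P? y
  ... | yes _ = there (∈-witnesses P-irr x∈xs px)
  ... | no  _ = ∈-witnesses P-irr x∈xs px

module _ (P : Phylogeny) where
  open Phylogeny P

  edge-target≢root : ∀ {u v} → E u v → v ≢ R
  edge-target≢root e refl = proj₁ (proj₂ tree) _ e

  edge-source≡par : ∀ {u v} → E u v → u ≡ par v
  edge-source≡par {v = v} e with proj₁ (proj₂ (proj₂ tree)) v tt (edge-target≢root e)
  ... | _ , _ , unique = trans (unique _ e) (sym (unique _ (par-edge v (edge-target≢root e))))

module _ (ℝs : RealNumbers) (P : Phylogeny) where
  open RealNumbers ℝs
  open WithReals ℝs
  open Phylogeny P
  open Contact

  isTemporal-from-par : ∀ {τ} → (∀ v → v ≢ R → τ (par v) < τ v) → IsTemporal P τ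
  isTemporal-from-par {τ} τ-par _ v e =
    subst (λ z → τ z < τ v) (sym (edge-source≡par P e)) (τ-par v (edge-target≢root P e))

  module _ {τ : Fin n → ℝ} where

    Occurs : Fin n → Contact P τ → Set
    Occurs w c = w ≡ u c ⊎ w ≡ v c

    occurs? : ∀ w → Decidable (Occurs w)
    occurs? w c = (w ≟ u c) ⊎-dec (w ≟ v c)

    occurs⇒InVC : ∀ {C w c} → c ∈ C → Occurs w c → InVC P C (w , t c)
    occurs⇒InVC {c = c} c∈C = lose c∈C ∘ Sum.map (cong (_, t c)) (cong (_, t c))

    InVC⇒occurs : ∀ {C w t₀} → InVC P C (w , t₀) → Σ (Contact P τ) λ c → c ∈ C × Occurs w c
    InVC⇒occurs h with find h
    ... | c , c∈C , inj₁ refl = c , c∈C , inj₁ refl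
    ... | c , c∈C , inj₂ refl = c , c∈C , inj₂ refl

    -- The value 0r at vertices occurring in no contact is junk.
    eventTime : List (Contact P τ) → Fin n → ℝ
    eventTime C w with any? (occurs? w) C
    ... | yes w∈C = t (Any.lookup w∈C)
    ... | no  _   = 0r

    eventTime-InVC : ∀ {C w} → Any (Occurs w) C → InVC P C (w , eventTime C w)
    eventTime-InVC {C} {w} w∈C with any? (occurs? w) C
    ... | yes w∈C′ = occurs⇒InVC (∈-lookup (Any.index w∈C′)) (Any.lookup-result w∈C′)
    ... | no  w∉C  = contradiction w∈C w∉C

    eventTime-unique : ∀ {C w t₀} → Simple P C → InVC P C (w , t₀) → eventTime C w ≡ t₀
    eventTime-unique {C} {w} {t₀} (_ , one-time) h with InVC⇒occurs h
    ... | c , c∈C , occ = one-time w _ t₀ (eventTime-InVC (lose c∈C occ)) h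

  module EventsOfContacts (X : PairSet P) {τ : Fin n → ℝ} {C : List (Contact P τ)}
                          (simple : Simple P C) (summary : SummaryIs P C X) where
    open PairSet X using (rel) renaming (sym to rel-sym)

    contact-related : ∀ {c} → c ∈ C → rel (u c) (v c) ≡ true
    contact-related {c} c∈C = Equivalence.from (summary (u c) (v c)) (lose c∈C (inj₁ (refl , refl)))

    related-contact : ∀ {a b} → rel a b ≡ true → Σ (Contact P τ) λ c → c ∈ C × Occurs a c × Occurs b c
    related-contact {a} {b} r with find (Equivalence.to (summary a b) r)
    ... | c , c∈C , inj₁ (refl , refl) = c , c∈C , inj₁ refl , inj₂ refl
    ... | c , c∈C , inj₂ (refl , refl) = c , c∈C , inj₂ refl , inj₁ refl

    occurs⇒InVX : ∀ {c w} → c ∈ C → Occurs w c → InVX X w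
    occurs⇒InVX {c} c∈C (inj₁ refl) = v c , trans (rel-sym (v c) (u c)) (contact-related c∈C)
    occurs⇒InVX {c} c∈C (inj₂ refl) = u c , contact-related c∈C

    InVX⇒occurs : ∀ {w} → InVX X w → Any (Occurs w) C
    InVX⇒occurs (_ , r) with related-contact r
    ... | c , c∈C , _ , occ = lose c∈C occ

    contact-eventTime : ∀ {c w} → c ∈ C → Occurs w c → eventTime C w ≡ t c
    contact-eventTime c∈C occ = eventTime-unique simple (occurs⇒InVC c∈C occ)

    occurs-bounds : ∀ {c w} → c ∈ C → Occurs w c → τ (par w) < t c × t c < τ w
    occurs-bounds {c} c∈C (inj₁ refl) = u-lo c , proj₁ (All.lookup (proj₁ simple) c∈C)
    occurs-bounds {c} c∈C (inj₂ refl) = v-lo c , proj₂ (All.lookup (proj₁ simple) c∈C)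

    eventTime-inside : ∀ w → InVX X w → τ (par w) < eventTime C w × eventTime C w < τ w
    eventTime-inside w (_ , r) with related-contact r
    ... | c , c∈C , _ , occ =
      subst (λ t₀ → τ (par w) < t₀ × t₀ < τ w) (sym (contact-eventTime c∈C occ)) (occurs-bounds c∈C occ)

    eventTime-simultaneous : ∀ a b → rel a b ≡ true → eventTime C a ≡ eventTime C b
    eventTime-simultaneous a b r with related-contact r
    ... | c , c∈C , occ-a , occ-b = trans (contact-eventTime c∈C occ-a) (sym (contact-eventTime c∈C occ-b))

    InVC⇒InVX : ∀ {e} → InVC P C e → InVX X (proj₁ e)
    InVC⇒InVX h with InVC⇒occurs h
    ... | c , c∈C , occ = occurs⇒InVX c∈C occ

    LinkC⇒related : ∀ {e e′} → LinkC P C e e′ → rel (proj₁ e) (proj₁ e′) ≡ true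
    LinkC⇒related l with find l
    ... | c , c∈C , inj₁ (refl , refl) = contact-related c∈C
    ... | c , c∈C , inj₂ (refl , refl) = trans (rel-sym (v c) (u c)) (contact-related c∈C)

    perfect⇒admissible : Perfect P C → Admissible X
    perfect⇒admissible =
      compatible-transport P (InVX X) (λ w → w) (λ a b → rel a b ≡ true) (InVC P C) proj₁ (LinkC P C)
        (λ w → w , eventTime C w) proj₁ (eventTime-InVC ∘ InVX⇒occurs) InVC⇒InVX
        (λ _ → refl) (λ _ → refl) LinkC⇒related (λ _ → refl)
        (λ {(w , _)} h → cong (w ,_) (eventTime-unique simple h))

  solution⇒admissible×timing : ∀ τmin τmax X → IsSolution P τmin τmax X →
                               Admissible X × TimingCondition P τmin τmax X
  solution⇒admissible×timing τmin τmax X (τ , τ-bounds , temporal , C , simple , perfect , summary) =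
    perfect⇒admissible perfect ,
    [ τ , eventTime C ] , τ-bounds , (λ v v≢R → temporal _ _ (par-edge v v≢R)) ,
    eventTime-inside , eventTime-simultaneous
    where open EventsOfContacts X simple summary

  module ContactsOfTiming (X : PairSet P) (τ′ : Fin n ⊎ Fin n → ℝ)
    (inside : ∀ v → InVX X v → τ′ (inj₁ (par v)) < τ′ (inj₂ v) × τ′ (inj₂ v) < τ′ (inj₁ v))
    (simultaneous : ∀ a b → PairSet.rel X a b ≡ true → τ′ (inj₂ a) ≡ τ′ (inj₂ b)) where
    open PairSet X using (rel; irrefl; nonroot) renaming (sym to rel-sym)

    τ : Fin n → ℝ
    τ = τ′ ∘ inj₁

    τ↑ : Fin n → ℝ
    τ↑ = τ′ ∘ inj₂

    Related : Fin n × Fin n → Set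
    Related (a , b) = rel a b ≡ true

    related-InVX₁ : ∀ {a b} → rel a b ≡ true → InVX X a
    related-InVX₁ {a} {b} r = b , trans (rel-sym b a) r

    related-inside₁ : ∀ {a b} → rel a b ≡ true → τ (par a) < τ↑ a × τ↑ a < τ a
    related-inside₁ {a} r = inside a (related-InVX₁ r)

    related-inside₂ : ∀ {a b} → rel a b ≡ true → τ (par b) < τ↑ a × τ↑ a < τ b
    related-inside₂ {a} {b} r =
      subst (λ t₀ → τ (par b) < t₀ × t₀ < τ b) (sym (simultaneous a b r)) (inside b (a , r))

    related? : Decidable Related
    related? (a , b) = rel a b Bool.≟ true

    pairContact : Σ (Fin n × Fin n) Related → Contact P τ
    pairContact ((a , b) , r) = record
      { u = a ; v = b ; t = τ↑ a
      ; u≢v = λ { refl → contradiction (trans (sym r) (irrefl a)) λ () }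
      ; u≢R = nonroot a b r
      ; v≢R = nonroot b a (trans (rel-sym b a) r)
      ; u-lo = proj₁ (related-inside₁ r)
      ; u-hi = inj₁ (proj₂ (related-inside₁ r))
      ; v-lo = proj₁ (related-inside₂ r)
      ; v-hi = inj₁ (proj₂ (related-inside₂ r))
      }

    contacts : List (Contact P τ)
    contacts = map pairContact (witnesses related? (cartesianProduct (allFin n) (allFin n)))

    pairContact-∈ : ∀ {a b} (r : rel a b ≡ true) → pairContact ((a , b) , r) ∈ contacts
    pairContact-∈ {a} {b} r =
      ∈-map⁺ pairContact (∈-witnesses related? (Decidable⇒UIP.≡-irrelevant Bool._≟_)
                                        (∈-cartesianProduct⁺ (∈-allFin a) (∈-allFin b)) r)

    contacts-any : ∀ {Q : Contact P τ → Set} → Any Q contacts → Σ (Σ (Fin n × Fin n) Related) (Q ∘ pairContact)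
    contacts-any = Any.satisfied ∘ Any.map⁻

    InVC⇒InVX×τ↑ : ∀ {w t₀} → InVC P contacts (w , t₀) → InVX X w × t₀ ≡ τ↑ w
    InVC⇒InVX×τ↑ h with contacts-any h
    ... | ((a , b) , r) , inj₁ refl = related-InVX₁ r , refl
    ... | ((a , b) , r) , inj₂ refl = (a , r) , simultaneous a b r

    simple : Simple P contacts
    simple = All.map⁺ (All.universal (λ (_ , r) → proj₂ (related-inside₁ r) , proj₂ (related-inside₂ r)) _) ,
             λ w t₁ t₂ h₁ h₂ → trans (proj₂ (InVC⇒InVX×τ↑ h₁)) (sym (proj₂ (InVC⇒InVX×τ↑ h₂)))

    summary : SummaryIs P contacts X
    summary a b = mk⇔ (λ r → lose (pairContact-∈ r) (inj₁ (refl , refl))) contact⇒related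
      where
      contact⇒related : Any (λ c → (u c ≡ a × v c ≡ b) ⊎ (u c ≡ b × v c ≡ a)) contacts → rel a b ≡ true
      contact⇒related h with contacts-any h
      ... | (_ , r) , inj₁ (refl , refl) = r
      ... | (_ , r) , inj₂ (refl , refl) = trans (rel-sym a b) r

    admissible⇒perfect : Admissible X → Perfect P contacts
    admissible⇒perfect =
      compatible-transport P (InVC P contacts) proj₁ (LinkC P contacts) (InVX X) (λ w → w) (λ a b → rel a b ≡ true)
        proj₁ (λ w → w , τ↑ w) (proj₁ ∘ InVC⇒InVX×τ↑)
        (λ {w} (a , r) → lose (pairContact-∈ r) (inj₂ (cong (w ,_) (sym (simultaneous a w r)))))
        (λ _ → refl) (λ _ → refl)
        (λ {a} {b} r → lose (pairContact-∈ r) (inj₁ (refl , cong (b ,_) (sym (simultaneous a b r)))))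
        (λ {(w , _)} h → cong (w ,_) (sym (proj₂ (InVC⇒InVX×τ↑ h))))
        (λ _ → refl)

  admissible×timing⇒solution : ∀ τmin τmax X → Admissible X × TimingCondition P τmin τmax X →
                               IsSolution P τmin τmax X
  admissible×timing⇒solution τmin τmax X (admissible , τ′ , τ-bounds , τ-par , inside , simultaneous) =
    τ , τ-bounds , isTemporal-from-par τ-par , contacts , simple , admissible⇒perfect admissible , summary
    where open ContactsOfTiming X τ′ inside simultaneous

proposition1 : (ℝs : RealNumbers) (P : Phylogeny)
    (τmin τmax : Fin (Phylogeny.n P) → WithReals.ℝ̄ ℝs) →
    (∀ v → WithReals._<̄_ ℝs (τmin v) (τmax v)) →
    (X : PairSet P) →
    WithReals.IsSolution ℝs P τmin τmax X ⇔
      (Admissible X × WithReals.TimingCondition ℝs P τmin τmax X)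
-- The intervals need not be nonempty: both sides already carry a τ inside them.
proposition1 ℝs P τmin τmax _ X =
  mk⇔ (solution⇒admissible×timing ℝs P τmin τmax X) (admissible×timing⇒solution ℝs P τmin τmax X)
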